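{- Let $G$ be a simple graph with vertex set $[n]$, and let $G'$ be the graph obtained from $G$ by relabeling each vertex $i$ as $n+1-i$ (so $\{i,j\}$ is an edge of $G'$ iff $\{n+1-i,n+1-j\}$ is an edge of $G$). Then $\mathrm{MTub}(G')$ is anti-isomorphic to $\mathrm{MTub}(G)$.
   Context: A tube of a graph $G$ on $[n]$ is a nonempty vertex set inducing a connected subgraph; tubes $X,Y$ are compatible if $X\subseteq Y$, $Y\subseteq X$, or $X\cup Y$ is not a tube; a maximal tubing is an inclusion-maximal set of pairwise compatible tubes. For a maximal tubing $\mathcal T$ and $x\in[n]$, $\mathcal T_\downarrow(x)$ is the smallest tube of $\mathcal T$ containing $x$, and for $T\in\mathcal T$, $\mathrm{top}_{\mathcal T}(T)$ is the unique $x$ with $\mathcal T_\downarrow(x)=T$. $\mathrm{MTub}(G)$ is the poset on maximal tubings of $G$ generated (reflexive-transitive closure) by covers $\mathcal T\lessdot\mathcal J$ when $\mathcal T\setminus\{T\}=\mathcal J\setminus\{J\}$ for single tubes $T\in\mathcal T,J\in\mathcal J$ with $\mathrm{top}_{\mathcal T}(T)<\mathrm{top}_{\mathcal J}(J)$ as integers. -}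

module Defs where

open import Data.Nat using (ℕ)
import Data.Nat as ℕ
open import Data.Bool using (Bool; true; false)
open import Data.Fin using (Fin; toℕ; opposite)
open import Data.Fin.Subset using (Subset; _∈_; _⊆_; _∪_; Nonempty)
open import Data.Product using (Σ; ∃; _×_; _,_)
open import Data.Sum using (_⊎_)
open import Relation.Nullary using (¬_)
open import Relation.Binary.PropositionalEquality using (_≡_; _≢_)
open import Relation.Binary.Construct.Closure.ReflexiveTransitive using (Star)
open import Function.Bundles using (_⇔_)

-- A simple graph on the vertex set [n], encoded as Fin n
-- (vertex i ∈ [n] is Fin element i-1; the integer order is preserved by toℕ).
record SimpleGraph (n : ℕ) : Set where
  field
    adj    : Fin n → Fin n → Bool
    sym    : ∀ i j → adj i j ≡ adj j i
    irrefl : ∀ i → adj i i ≡ false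
open SimpleGraph public

-- Relabel vertex i as n+1-i  (on Fin n: i ↦ opposite i, i.e. n-1-i).
reverseGraph : ∀ {n} → SimpleGraph n → SimpleGraph n
reverseGraph G = record
  { adj    = λ i j → adj G (opposite i) (opposite j)
  ; sym    = λ i j → sym G (opposite i) (opposite j)
  ; irrefl = λ i → irrefl G (opposite i)
  }

data Reach {n} (G : SimpleGraph n) (X : Subset n) : Fin n → Fin n → Set where
  here : ∀ {x} → x ∈ X → Reach G X x x
  step : ∀ {x z y} → x ∈ X → adj G x z ≡ true → Reach G X z y → Reach G X x y

InducesConnected : ∀ {n} → SimpleGraph n → Subset n → Set
InducesConnected G X = ∀ x y → x ∈ X → y ∈ X → Reach G X x y

IsTube : ∀ {n} → SimpleGraph n → Subset n → Set
IsTube G X = Nonempty X × InducesConnected G X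

Compatible : ∀ {n} → SimpleGraph n → Subset n → Subset n → Set
Compatible G X Y = X ⊆ Y ⊎ (Y ⊆ X ⊎ ¬ IsTube G (X ∪ Y))

SetOfSets : ℕ → Set
SetOfSets n = Subset n → Bool

_∈ₛ_ : ∀ {n} → Subset n → SetOfSets n → Set
X ∈ₛ 𝒯 = 𝒯 X ≡ true

IsTubing : ∀ {n} → SimpleGraph n → SetOfSets n → Set
IsTubing G 𝒯 = (∀ X → X ∈ₛ 𝒯 → IsTube G X)
             × (∀ X Y → X ∈ₛ 𝒯 → Y ∈ₛ 𝒯 → Compatible G X Y)

IsMaximalTubing : ∀ {n} → SimpleGraph n → SetOfSets n → Set
IsMaximalTubing G 𝒯 = IsTubing G 𝒯
  × (∀ 𝒮 → IsTubing G 𝒮 → (∀ X → X ∈ₛ 𝒯 → X ∈ₛ 𝒮) → ∀ X → X ∈ₛ 𝒮 → X ∈ₛ 𝒯)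

record MaxTubing {n} (G : SimpleGraph n) : Set where
  constructor mkMaxTubing
  field
    tubes   : SetOfSets n
    maximal : IsMaximalTubing G tubes
open MaxTubing public

_≈ₜ_ : ∀ {n} {G : SimpleGraph n} → MaxTubing G → MaxTubing G → Set
𝒯 ≈ₜ 𝒥 = ∀ X → tubes 𝒯 X ≡ tubes 𝒥 X

-- 𝒯↓(x) = T : T is the smallest tube of 𝒯 containing x.
-- Equivalently top_𝒯(T) = x.
IsTop : ∀ {n} → SetOfSets n → Subset n → Fin n → Set
IsTop 𝒯 T x = T ∈ₛ 𝒯 × x ∈ T × (∀ T' → T' ∈ₛ 𝒯 → x ∈ T' → T ⊆ T')

Cover : ∀ {n} (G : SimpleGraph n) → MaxTubing G → MaxTubing G → Set
Cover {n} G 𝒯 𝒥 = Σ (Subset n) λ T → Σ (Subset n) λ J →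
    T ∈ₛ tubes 𝒯 × J ∈ₛ tubes 𝒥
  × (∀ X → ((X ∈ₛ tubes 𝒯) × X ≢ T) ⇔ ((X ∈ₛ tubes 𝒥) × X ≢ J))
  × Σ (Fin n) λ x → Σ (Fin n) λ y →
      IsTop (tubes 𝒯) T x × IsTop (tubes 𝒥) J y × toℕ x ℕ.< toℕ y

-- Order of MTub(G): reflexive-transitive closure of the covers, taken on
-- maximal tubings up to equality of tube sets (≈ₜ).
data Step {n} (G : SimpleGraph n) (𝒯 𝒥 : MaxTubing G) : Set where
  cover : Cover G 𝒯 𝒥 → Step G 𝒯 𝒥
  same  : 𝒯 ≈ₜ 𝒥 → Step G 𝒯 𝒥

MTubLeq : ∀ {n} (G : SimpleGraph n) → MaxTubing G → MaxTubing G → Set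
MTubLeq G = Star (Step G)

record AntiIsomorphism {n} (H G : SimpleGraph n) : Set where
  field
    to        : MaxTubing H → MaxTubing G
    from      : MaxTubing G → MaxTubing H
    to-cong   : ∀ 𝒯 𝒥 → 𝒯 ≈ₜ 𝒥 → to 𝒯 ≈ₜ to 𝒥
    from-cong : ∀ 𝒯 𝒥 → 𝒯 ≈ₜ 𝒥 → from 𝒯 ≈ₜ from 𝒥
    from-to   : ∀ 𝒯 → from (to 𝒯) ≈ₜ 𝒯
    to-from   : ∀ 𝒯 → to (from 𝒯) ≈ₜ 𝒯
    reverses  : ∀ 𝒯 𝒥 → MTubLeq H 𝒯 𝒥 ⇔ MTubLeq G (to 𝒥) (to 𝒯)

{-# OPTIONS --safe #-}
-- Relabelling i ↦ n+1−i is an involution on vertex sets that carries the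
-- tubes of G′ onto the tubes of G and commutes with inclusion and union, so it
-- induces a bijection between maximal tubings which moves the smallest tube
-- containing x to the smallest tube containing n+1−x.  A cover exchanging T
-- for J with top(T) < top(J) is thus sent to the exchange of the relabelled J
-- for the relabelled T, whose tops n+1−top(J) < n+1−top(T) are again in
-- increasing order: covers are reversed.
module Submission where

open import Data.Nat using (ℕ; s≤s)
open import Defs hiding (sym)

open import Data.Bool using (_∨_)
open import Data.Nat.Properties using (∸-monoʳ-<)
open import Data.Fin using (Fin; opposite; _<_)
open import Data.Fin.Properties using (opposite-involutive; opposite-prop; toℕ<n)
open import Data.Fin.Subset using (Subset; _∈_; _⊆_; _∪_)
open import Data.Vec using (tabulate; lookup)
open import Data.Vec.Properties using (lookup∘tabulate; lookup-zipWith; []=⇒lookup; lookup⇒[]=)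
open import Data.Vec.Relation.Binary.Pointwise.Extensional using (ext; Pointwise-≡⇒≡)
open import Data.Product using (_×_; _,_)
open import Data.Product.Function.NonDependent.Propositional using (_×-⇔_)
open import Data.Sum using (inj₁; inj₂)
open import Function using (_∘_; id)
open import Function.Bundles using (_⇔_; mk⇔)
open import Function.Properties.Equivalence using () renaming (refl to ⇔-refl; sym to ⇔-sym; trans to ⇔-trans)
open import Relation.Binary.PropositionalEquality
  using (_≡_; _≢_; refl; sym; trans; cong; cong₂; subst; subst₂; module ≡-Reasoning)
open import Relation.Binary.Construct.Closure.ReflexiveTransitive using (ε; _◅_; _◅◅_; gmap; reverse)

private
  variable
    n : ℕ
    A B G H : SimpleGraph n
    X Y : Subset n
    𝒯 𝒥 𝒯′ 𝒥′ : MaxTubing G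

relabel : Subset n → Subset n
relabel X = tabulate (lookup X ∘ opposite)

lookup-relabel : ∀ (X : Subset n) i → lookup (relabel X) i ≡ lookup X (opposite i)
lookup-relabel X = lookup∘tabulate (lookup X ∘ opposite)

∈-relabel⁺ : ∀ {i} → opposite i ∈ X → i ∈ relabel X
∈-relabel⁺ {X = X} {i} p = lookup⇒[]= i (relabel X) (trans (lookup-relabel X i) ([]=⇒lookup p))

∈-relabel⁻ : ∀ {i} → i ∈ relabel X → opposite i ∈ X
∈-relabel⁻ {X = X} {i} p = lookup⇒[]= (opposite i) X (trans (sym (lookup-relabel X i)) ([]=⇒lookup p))

opposite-∈-relabel : ∀ {i} → i ∈ X → opposite i ∈ relabel X
opposite-∈-relabel {X = X} {i} i∈X = ∈-relabel⁺ (subst (_∈ X) (sym (opposite-involutive i)) i∈X)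

relabel-involutive : ∀ (X : Subset n) → relabel (relabel X) ≡ X
relabel-involutive X = Pointwise-≡⇒≡ (ext λ i → begin
  lookup (relabel (relabel X)) i       ≡⟨ lookup-relabel (relabel X) i ⟩
  lookup (relabel X) (opposite i)      ≡⟨ lookup-relabel X (opposite i) ⟩
  lookup X (opposite (opposite i))     ≡⟨ cong (lookup X) (opposite-involutive i) ⟩
  lookup X i                           ∎)
  where open ≡-Reasoning

relabel-∪ : ∀ (X Y : Subset n) → relabel (X ∪ Y) ≡ relabel X ∪ relabel Y
relabel-∪ X Y = Pointwise-≡⇒≡ (ext λ i → begin
  lookup (relabel (X ∪ Y)) i                           ≡⟨ lookup-relabel (X ∪ Y) i ⟩
  lookup (X ∪ Y) (opposite i)                          ≡⟨ lookup-zipWith _∨_ (opposite i) X Y ⟩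
  lookup X (opposite i) ∨ lookup Y (opposite i)        ≡⟨ sym (cong₂ _∨_ (lookup-relabel X i) (lookup-relabel Y i)) ⟩
  lookup (relabel X) i ∨ lookup (relabel Y) i          ≡⟨ sym (lookup-zipWith _∨_ i (relabel X) (relabel Y)) ⟩
  lookup (relabel X ∪ relabel Y) i                     ∎)
  where open ≡-Reasoning

relabel-mono : X ⊆ Y → relabel X ⊆ relabel Y
relabel-mono X⊆Y = ∈-relabel⁺ ∘ X⊆Y ∘ ∈-relabel⁻

relabel-cancel-⊆ : relabel X ⊆ relabel Y → X ⊆ Y
relabel-cancel-⊆ {X = X} {Y} = subst₂ _⊆_ (relabel-involutive X) (relabel-involutive Y) ∘ relabel-mono

≡-relabel : X ≡ relabel Y → relabel X ≡ Y
≡-relabel {Y = Y} X≡Y = trans (cong relabel X≡Y) (relabel-involutive Y)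

≢-relabel : (X ≢ relabel Y) ⇔ (relabel X ≢ Y)
≢-relabel = mk⇔
  (λ X≢ e → X≢ (sym (≡-relabel (sym e))))
  (λ X≢ e → X≢ (≡-relabel e))

opposite-reverses-< : ∀ {i j : Fin n} → i < j → opposite j < opposite i
opposite-reverses-< {i = i} {j} i<j rewrite opposite-prop i | opposite-prop j =
  ∸-monoʳ-< (s≤s i<j) (toℕ<n j)

record Reversal (A B : SimpleGraph n) : Set where
  constructor reversal
  field adj-opposite : ∀ i j → adj B i j ≡ adj A (opposite i) (opposite j)
open Reversal

Reversal-sym : Reversal A B → Reversal B A
Reversal-sym {A = A} {B = B} r = reversal λ i j → sym (begin
  adj B (opposite i) (opposite j)                       ≡⟨ adj-opposite r (opposite i) (opposite j) ⟩
  adj A (opposite (opposite i)) (opposite (opposite j)) ≡⟨ cong₂ (adj A) (opposite-involutive i) (opposite-involutive j) ⟩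
  adj A i j                                             ∎)
  where open ≡-Reasoning

reach-relabel : Reversal A B → ∀ {u v} → Reach A X u v → Reach B (relabel X) (opposite u) (opposite v)
reach-relabel r (here u∈X) = here (opposite-∈-relabel u∈X)
reach-relabel r (step {x} {z} x∈X xz path) =
  step (opposite-∈-relabel x∈X) (trans (sym (adj-opposite (Reversal-sym r) x z)) xz) (reach-relabel r path)

isTube-relabel : Reversal A B → IsTube A X → IsTube B (relabel X)
isTube-relabel {B = B} {X = X} r ((x , x∈X) , connected) =
  (opposite x , opposite-∈-relabel x∈X) , λ y z y∈ z∈ →
  subst₂ (Reach B (relabel X)) (opposite-involutive y) (opposite-involutive z)
    (reach-relabel r (connected _ _ (∈-relabel⁻ y∈) (∈-relabel⁻ z∈)))

isTube-relabel⁻ : Reversal A B → IsTube A (relabel X) → IsTube B X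
isTube-relabel⁻ {B = B} {X = X} r = subst (IsTube B) (relabel-involutive X) ∘ isTube-relabel r

compatible-relabel : Reversal A B → Compatible A (relabel X) (relabel Y) → Compatible B X Y
compatible-relabel r (inj₁ X⊆Y)        = inj₁ (relabel-cancel-⊆ X⊆Y)
compatible-relabel r (inj₂ (inj₁ Y⊆X)) = inj₂ (inj₁ (relabel-cancel-⊆ Y⊆X))
compatible-relabel {A = A} {X = X} {Y} r (inj₂ (inj₂ ¬tube)) =
  inj₂ (inj₂ (¬tube ∘ subst (IsTube A) (relabel-∪ X Y) ∘ isTube-relabel (Reversal-sym r)))

relabelₛ : SetOfSets n → SetOfSets n
relabelₛ 𝒯 = 𝒯 ∘ relabel

∈ₛ-relabelₛ : ∀ (𝒯 : SetOfSets n) X → X ∈ₛ 𝒯 → relabel X ∈ₛ relabelₛ 𝒯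
∈ₛ-relabelₛ 𝒯 X = subst (_∈ₛ 𝒯) (sym (relabel-involutive X))

isTubing-relabelₛ : ∀ {𝒯} → Reversal A B → IsTubing A 𝒯 → IsTubing B (relabelₛ 𝒯)
isTubing-relabelₛ r (allTubes , compatible) =
  (λ X X∈ → isTube-relabel⁻ r (allTubes _ X∈)) ,
  (λ X Y X∈ Y∈ → compatible-relabel r (compatible _ _ X∈ Y∈))

isMaximalTubing-relabelₛ : ∀ {𝒯} → Reversal A B → IsMaximalTubing A 𝒯 → IsMaximalTubing B (relabelₛ 𝒯)
isMaximalTubing-relabelₛ {𝒯 = 𝒯} r (tubing , isMaximal) =
  isTubing-relabelₛ r tubing ,
  λ 𝒮 𝒮-tubing 𝒯⊆𝒮 Y Y∈𝒮 →
    isMaximal (relabelₛ 𝒮) (isTubing-relabelₛ (Reversal-sym r) 𝒮-tubing)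
      (λ X X∈𝒯 → 𝒯⊆𝒮 (relabel X) (∈ₛ-relabelₛ 𝒯 X X∈𝒯)) (relabel Y) (∈ₛ-relabelₛ 𝒮 Y Y∈𝒮)

relabelᵐ : Reversal A B → MaxTubing A → MaxTubing B
relabelᵐ r 𝒯 = mkMaxTubing (relabelₛ (tubes 𝒯)) (isMaximalTubing-relabelₛ r (maximal 𝒯))

relabelᵐ-involutive : (r : Reversal A B) (r′ : Reversal B A) → ∀ 𝒯 → relabelᵐ r′ (relabelᵐ r 𝒯) ≈ₜ 𝒯
relabelᵐ-involutive r r′ 𝒯 = cong (tubes 𝒯) ∘ relabel-involutive

isTop-relabelₛ : ∀ {𝒯 : SetOfSets n} {T x} → IsTop 𝒯 T x → IsTop (relabelₛ 𝒯) (relabel T) (opposite x)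
isTop-relabelₛ {𝒯 = 𝒯} {T} {x} (T∈ , x∈T , least) =
  ∈ₛ-relabelₛ 𝒯 T T∈ , opposite-∈-relabel x∈T ,
  λ T′ T′∈ x∈T′ → subst (relabel T ⊆_) (relabel-involutive T′) (relabel-mono (least _ T′∈ (∈-relabel⁺ x∈T′)))

relabel-exchange : ∀ {𝒯 𝒥 : SetOfSets n} {T J} →
  (∀ X → (X ∈ₛ 𝒯 × X ≢ T) ⇔ (X ∈ₛ 𝒥 × X ≢ J)) →
  ∀ X → (X ∈ₛ relabelₛ 𝒥 × X ≢ relabel J) ⇔ (X ∈ₛ relabelₛ 𝒯 × X ≢ relabel T)
relabel-exchange exchange X =
  ⇔-trans (⇔-refl ×-⇔ ≢-relabel) (⇔-trans (⇔-sym (exchange (relabel X))) (⇔-refl ×-⇔ ⇔-sym ≢-relabel))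

cover-relabel : (r : Reversal A B) (𝒯 𝒥 : MaxTubing A) → Cover A 𝒯 𝒥 → Cover B (relabelᵐ r 𝒥) (relabelᵐ r 𝒯)
cover-relabel r 𝒯 𝒥 (T , J , T∈ , J∈ , exchange , x , y , top-T , top-J , x<y) =
  relabel J , relabel T , ∈ₛ-relabelₛ (tubes 𝒥) J J∈ , ∈ₛ-relabelₛ (tubes 𝒯) T T∈ , relabel-exchange exchange ,
  opposite y , opposite x , isTop-relabelₛ top-J , isTop-relabelₛ top-T , opposite-reverses-< x<y

step-relabel : (r : Reversal A B) → Step A 𝒯 𝒥 → Step B (relabelᵐ r 𝒥) (relabelᵐ r 𝒯)
step-relabel {𝒯 = 𝒯} {𝒥} r (cover c) = cover (cover-relabel r 𝒯 𝒥 c)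
step-relabel r (same e) = same (sym ∘ e ∘ relabel)

mtubLeq-relabel : (r : Reversal A B) → MTubLeq A 𝒯 𝒥 → MTubLeq B (relabelᵐ r 𝒥) (relabelᵐ r 𝒯)
mtubLeq-relabel r = reverse id ∘ gmap (relabelᵐ r) (step-relabel r)

mtubLeq-resp-≈ₜ : 𝒯 ≈ₜ 𝒯′ → 𝒥 ≈ₜ 𝒥′ → MTubLeq G 𝒯 𝒥 → MTubLeq G 𝒯′ 𝒥′
mtubLeq-resp-≈ₜ 𝒯≈𝒯′ 𝒥≈𝒥′ 𝒯≤𝒥 = same (sym ∘ 𝒯≈𝒯′) ◅ 𝒯≤𝒥 ◅◅ same 𝒥≈𝒥′ ◅ ε

reversal⇒antiIsomorphism : Reversal H G → AntiIsomorphism H G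
reversal⇒antiIsomorphism {H = H} {G = G} r = record
  { to        = relabelᵐ r
  ; from      = relabelᵐ r′
  ; to-cong   = λ _ _ 𝒯≈𝒥 → 𝒯≈𝒥 ∘ relabel
  ; from-cong = λ _ _ 𝒯≈𝒥 → 𝒯≈𝒥 ∘ relabel
  ; from-to   = relabelᵐ-involutive r r′
  ; to-from   = relabelᵐ-involutive r′ r
  ; reverses  = λ 𝒯 𝒥 → mk⇔ (mtubLeq-relabel r)
      (mtubLeq-resp-≈ₜ (relabelᵐ-involutive r r′ 𝒯) (relabelᵐ-involutive r r′ 𝒥) ∘ mtubLeq-relabel r′)
  }
  where
    r′ : Reversal G H
    r′ = Reversal-sym r

lemma2p4 : ∀ (n : ℕ) (G : SimpleGraph n) → AntiIsomorphism (reverseGraph G) G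
lemma2p4 n G = reversal⇒antiIsomorphism (Reversal-sym {A = G} (reversal λ _ _ → refl))
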